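{- Let $\mathcal{C}$ be a hypergraph with $n$ vertices. Then $\tilde\gamma(\operatorname{Ind}(\mathcal{C}))\geq \frac{n}{\Delta(\mathcal{C})}$.
   Context: A hypergraph $\mathcal{C}$ on a finite vertex set $V$ is a family of pairwise incomparable subsets of $V$ (edges), each of cardinality at least $2$; isolated vertices allowed. $\operatorname{Ind}(\mathcal{C})$ is the simplicial complex on $V$ of subsets containing no edge. For a simplicial complex $\Delta$ on $V$ and $A\subseteq V$, $\tilde{sp}_\Delta(A)=\{v\in V: \text{there is a face }\sigma\subseteq A\text{ of }\Delta\text{ with }\sigma\cup\{v\}\notin\Delta\}$, and $\tilde\gamma(\Delta)$ is the minimum size of $A\subseteq V$ with $\tilde{sp}_\Delta(A)=V$ ($\infty$ if none exists). The degree of a vertex is the number of edges containing it; $\Delta(\mathcal{C})$ is the maximum degree, with $\Delta(\mathcal{C})=1$ if $V=\emptyset$. -}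

module Defs where

open import Data.Nat using (ℕ; zero; suc; _≤_; _⊔_)
open import Data.Fin using (Fin)
open import Data.Fin.Subset using (Subset; _∈_; _⊆_; _∪_; ⁅_⁆; ∣_∣)
open import Data.Fin.Subset.Properties using (_∈?_)
open import Data.List using (List; length; filter; foldr; map)
open import Data.List.Membership.Propositional renaming (_∈_ to _∈ₗ_)
open import Data.List.Relation.Unary.All using (All)
open import Data.List.Relation.Unary.AllPairs using (AllPairs)
open import Data.Vec using (allFin; toList)
open import Data.Product using (Σ; _×_; ∃)
open import Relation.Nullary using (¬_)

record Hypergraph (n : ℕ) : Set where
  field
    edges         : List (Subset n)
    incomparable  : AllPairs (λ e f → ¬ (e ⊆ f) × ¬ (f ⊆ e)) edges
    edgeSize      : All (λ e → 2 ≤ ∣ e ∣) edges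
open Hypergraph public

IsFaceInd : ∀ {n} → Hypergraph n → Subset n → Set
IsFaceInd C σ = ∀ e → e ∈ₗ edges C → ¬ (e ⊆ σ)

InSp : ∀ {n} → Hypergraph n → Subset n → Fin n → Set
InSp C A v = Σ (Subset _) λ σ → σ ⊆ A × IsFaceInd C σ × ¬ IsFaceInd C (σ ∪ ⁅ v ⁆)

Spans : ∀ {n} → Hypergraph n → Subset n → Set
Spans C A = ∀ v → InSp C A v

degree : ∀ {n} → Hypergraph n → Fin n → ℕ
degree C v = length (filter (v ∈?_) (edges C))

-- maximum degree, with the convention Δ = 1 when V = ∅
maxDegree : ∀ {n} → Hypergraph n → ℕ
maxDegree {zero}  C = 1
maxDegree {suc n} C = foldr _⊔_ 0 (map (degree C) (toList (allFin (suc n))))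

-- Every vertex v spanned by A lies in an edge e ⊆ A ∪ {v}; since |e| ≥ 2, e also
-- meets A, in v itself when v ∈ A. Charging v to such a pair (a , e) with a ∈ A ∩ e
-- is injective: if v and w share (a , e), then w ∈ e ⊆ A ∪ {v} and v ∈ e ⊆ A ∪ {w},
-- and either one of them lies outside A, or both equal a. The pairs (a , e) with
-- a ∈ A ∩ e number Σ_{a ∈ A} deg a ≤ |A| Δ.
module Submission where

open import Defs
open import Data.Nat using (ℕ; zero; suc; _≤_; _*_; _+_; _⊔_; z≤n; s≤s)
open import Data.Nat.Properties using (≤-trans; ≤-reflexive; m≤m⊔n; m≤n⊔m; +-mono-≤; module ≤-Reasoning)
open import Data.Fin using (Fin; zero; suc)
open import Data.Fin.Properties using (injective⇒≤; any?) renaming (_≟_ to _≟ᶠ_)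
open import Data.Fin.Subset using (Subset; ∣_∣; _∈_; _⊆_; ⁅_⁆; inside; outside)
open import Data.Fin.Subset.Properties
  using (_∈?_; _⊆?_; x∈⁅y⁆⇒x≡y; x∈⁅x⁆; x∈p∪q⁻; p⊆q⇒∣p∣≤∣q∣; ∣⁅x⁆∣≡1)
open import Data.Vec using ([]; _∷_; here; there)
open import Data.Vec.Membership.Propositional.Properties using (∈-allFin⁺; ∈-toList⁺)
open import Data.List using (List; []; _∷_; length; filter; foldr; map; _++_; lookup)
open import Data.List.Properties using (length-++; length-map)
open import Data.List.Membership.Propositional renaming (_∈_ to _∈ₗ_) using (lose; find)
open import Data.List.Membership.Propositional.Properties using (∈-map⁺; ∈-++⁺ˡ; ∈-++⁺ʳ; ∈-filter⁺)
open import Data.List.Relation.Unary.Any as Any using (Any)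
open import Data.List.Relation.Unary.Any.Properties using (lookup-index)
import Data.List.Relation.Unary.All as All
open import Data.Product using (∃-syntax; _×_; _,_; proj₁; proj₂; map₁)
open import Data.Sum using (_⊎_; inj₁; inj₂)
open import Data.Empty using (⊥-elim)
open import Function using (_∘_; Injective)
open import Relation.Nullary using (¬_; yes; no)
open import Relation.Nullary.Decidable using (_×-dec_; ¬?)
open import Relation.Binary.PropositionalEquality using (_≡_; _≢_; refl; sym; trans; cong; cong₂; subst)

private
  variable
    m : ℕ
    X : Set

incidences : Subset m → (Fin m → List X) → List (Fin m × X)
incidences []            g = []
incidences (inside ∷ A)  g = map (zero ,_) (g zero) ++ map (map₁ suc) (incidences A (g ∘ suc))
incidences (outside ∷ A) g = map (map₁ suc) (incidences A (g ∘ suc))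

length-incidences≤ : (A : Subset m) (g : Fin m → List X) {D : ℕ} →
                     (∀ a → length (g a) ≤ D) → length (incidences A g) ≤ ∣ A ∣ * D
length-incidences≤ []            g g≤D = z≤n
length-incidences≤ (inside ∷ A)  g {D} g≤D = begin
  length (map (zero ,_) (g zero) ++ map (map₁ suc) rest)
    ≡⟨ length-++ (map (zero ,_) (g zero)) ⟩
  length (map (zero ,_) (g zero)) + length (map (map₁ suc) rest)
    ≡⟨ cong₂ _+_ (length-map (zero ,_) (g zero)) (length-map (map₁ suc) rest) ⟩
  length (g zero) + length rest
    ≤⟨ +-mono-≤ (g≤D zero) (length-incidences≤ A (g ∘ suc) (g≤D ∘ suc)) ⟩
  D + ∣ A ∣ * D
    ∎
  where
  open ≤-Reasoning
  rest = incidences A (g ∘ suc)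
length-incidences≤ (outside ∷ A) g g≤D = begin
  length (map (map₁ suc) (incidences A (g ∘ suc)))  ≡⟨ length-map (map₁ suc) (incidences A (g ∘ suc)) ⟩
  length (incidences A (g ∘ suc))                    ≤⟨ length-incidences≤ A (g ∘ suc) (g≤D ∘ suc) ⟩
  ∣ A ∣ * _                                           ∎
  where open ≤-Reasoning

∈-incidences : (A : Subset m) (g : Fin m → List X) {a : Fin m} {x : X} →
               a ∈ A → x ∈ₗ g a → (a , x) ∈ₗ incidences A g
∈-incidences (inside ∷ A)  g here       x∈ = ∈-++⁺ˡ (∈-map⁺ (zero ,_) x∈)
∈-incidences (inside ∷ A)  g (there a∈) x∈ =
  ∈-++⁺ʳ (map (zero ,_) (g zero)) (∈-map⁺ (map₁ suc) (∈-incidences A (g ∘ suc) a∈ x∈))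
∈-incidences (outside ∷ A) g (there a∈) x∈ = ∈-map⁺ (map₁ suc) (∈-incidences A (g ∘ suc) a∈ x∈)

injective-into-list⇒≤ : ∀ {n} {xs : List X} (f : Fin n → X) →
                        Injective _≡_ _≡_ f → (∀ v → f v ∈ₗ xs) → n ≤ length xs
injective-into-list⇒≤ {xs = xs} f f-inj f∈xs = injective⇒≤ {f = Any.index ∘ f∈xs} index-inj
  where
  index-inj : Injective _≡_ _≡_ (Any.index ∘ f∈xs)
  index-inj {v} {w} eq = f-inj
    (trans (lookup-index (f∈xs v)) (trans (cong (lookup xs) eq) (sym (lookup-index (f∈xs w)))))

∈⇒≤foldr-⊔ : ∀ {x} (xs : List ℕ) → x ∈ₗ xs → x ≤ foldr _⊔_ 0 xs
∈⇒≤foldr-⊔ (y ∷ ys) (Any.here refl) = m≤m⊔n y _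
∈⇒≤foldr-⊔ (y ∷ ys) (Any.there x∈)  = ≤-trans (∈⇒≤foldr-⊔ ys x∈) (m≤n⊔m y _)

degree≤maxDegree : (C : Hypergraph m) (a : Fin m) → degree C a ≤ maxDegree C
degree≤maxDegree {suc m} C a = ∈⇒≤foldr-⊔ _ (∈-map⁺ (degree C) (∈-toList⁺ (∈-allFin⁺ a)))

2≤∣p∣⇒∃-∈-≢ : ∀ {p : Subset m} (v : Fin m) → 2 ≤ ∣ p ∣ → ∃[ x ] x ∈ p × x ≢ v
2≤∣p∣⇒∃-∈-≢ {p = p} v 2≤∣p∣ with any? (λ x → (x ∈? p) ×-dec ¬? (x ≟ᶠ v))
... | yes x∈p≢v = x∈p≢v
... | no  none  = ⊥-elim (2≰1 (≤-trans 2≤∣p∣ (≤-trans (p⊆q⇒∣p∣≤∣q∣ p⊆⁅v⁆) (≤-reflexive (∣⁅x⁆∣≡1 v)))))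
  where
  p⊆⁅v⁆ : p ⊆ ⁅ v ⁆
  p⊆⁅v⁆ {x} x∈p with x ≟ᶠ v
  ... | yes refl = x∈⁅x⁆ v
  ... | no  x≢v  = ⊥-elim (none (x , x∈p , x≢v))

  2≰1 : ¬ 2 ≤ 1
  2≰1 (s≤s ())

¬IsFace⇒∃-edge-⊆ : (C : Hypergraph m) {σ : Subset m} →
                   ¬ IsFaceInd C σ → ∃[ e ] e ∈ₗ edges C × e ⊆ σ
¬IsFace⇒∃-edge-⊆ C {σ} ¬face with Any.any? (_⊆? σ) (edges C)
... | yes some-e⊆σ = find some-e⊆σ
... | no  no-e⊆σ   = ⊥-elim (¬face (λ e e∈C e⊆σ → no-e⊆σ (lose e∈C e⊆σ)))

record Charge (C : Hypergraph m) (A : Subset m) (v : Fin m) : Set where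
  field
    anchor      : Fin m
    edge        : Subset m
    edge∈C      : edge ∈ₗ edges C
    v∈edge      : v ∈ edge
    edge⊆A∪v    : ∀ {x} → x ∈ edge → x ≡ v ⊎ x ∈ A
    anchor∈A    : anchor ∈ A
    anchor∈edge : anchor ∈ edge
    anchor≡v    : v ∈ A → anchor ≡ v
open Charge

InSp⇒Charge : (C : Hypergraph m) (A : Subset m) (v : Fin m) → InSp C A v → Charge C A v
InSp⇒Charge C A v (σ , σ⊆A , face , ¬face∪v) with ¬IsFace⇒∃-edge-⊆ C ¬face∪v
... | e , e∈C , e⊆σ∪v = record
  { anchor = proj₁ a ; edge = e ; edge∈C = e∈C ; v∈edge = v∈e ; edge⊆A∪v = e⊆A∪v
  ; anchor∈A = proj₁ (proj₂ a) ; anchor∈edge = proj₁ (proj₂ (proj₂ a)) ; anchor≡v = proj₂ (proj₂ (proj₂ a)) }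
  where
  e⊆A∪v : ∀ {x} → x ∈ e → x ≡ v ⊎ x ∈ A
  e⊆A∪v x∈e with x∈p∪q⁻ σ ⁅ v ⁆ (e⊆σ∪v x∈e)
  ... | inj₁ x∈σ = inj₂ (σ⊆A x∈σ)
  ... | inj₂ x∈v = inj₁ (x∈⁅y⁆⇒x≡y v x∈v)

  -- otherwise e ⊆ σ, but σ is a face
  v∈e : v ∈ e
  v∈e with v ∈? e
  ... | yes v∈e = v∈e
  ... | no  v∉e = ⊥-elim (face e e∈C e⊆σ)
    where
    e⊆σ : e ⊆ σ
    e⊆σ {x} x∈e with x∈p∪q⁻ σ ⁅ v ⁆ (e⊆σ∪v x∈e)
    ... | inj₁ x∈σ = x∈σ
    ... | inj₂ x∈v = ⊥-elim (v∉e (subst (_∈ e) (x∈⁅y⁆⇒x≡y v x∈v) x∈e))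

  a : ∃[ a ] a ∈ A × a ∈ e × (v ∈ A → a ≡ v)
  a with v ∈? A
  ... | yes v∈A = v , v∈A , v∈e , λ _ → refl
  ... | no  v∉A with 2≤∣p∣⇒∃-∈-≢ v (All.lookup (edgeSize C) e∈C)
  ...   | x , x∈e , x≢v with e⊆A∪v x∈e
  ...     | inj₁ x≡v = ⊥-elim (x≢v x≡v)
  ...     | inj₂ x∈A = x , x∈A , x∈e , λ v∈A → ⊥-elim (v∉A v∈A)

∉A-∈-edge⇒≡ : ∀ {C : Hypergraph m} {A v w} (c : Charge C A w) → ¬ v ∈ A → v ∈ edge c → v ≡ w
∉A-∈-edge⇒≡ c v∉A v∈edge with edge⊆A∪v c v∈edge
... | inj₁ v≡w = v≡w
... | inj₂ v∈A = ⊥-elim (v∉A v∈A)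

Charge-injective : ∀ {C : Hypergraph m} {A v w} (cv : Charge C A v) (cw : Charge C A w) →
                   anchor cv ≡ anchor cw → edge cv ≡ edge cw → v ≡ w
Charge-injective {A = A} {v} {w} cv cw a≡ e≡ with v ∈? A | w ∈? A
... | no  v∉A | _       = ∉A-∈-edge⇒≡ cw v∉A (subst (v ∈_) e≡ (v∈edge cv))
... | yes _   | no  w∉A = sym (∉A-∈-edge⇒≡ cv w∉A (subst (w ∈_) (sym e≡) (v∈edge cw)))
... | yes v∈A | yes w∈A = trans (sym (anchor≡v cv v∈A)) (trans a≡ (anchor≡v cw w∈A))

lemma3p12 : (n : ℕ) (C : Hypergraph n) (A : Subset n) →
    Spans C A → n ≤ ∣ A ∣ * maxDegree C
lemma3p12 n C A spans = begin
  n                                ≤⟨ injective-into-list⇒≤ (λ v → anchor (c v) , edge (c v)) charge-inj charge∈ ⟩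
  length (incidences A incident)   ≤⟨ length-incidences≤ A incident (degree≤maxDegree C) ⟩
  ∣ A ∣ * maxDegree C              ∎
  where
  open ≤-Reasoning
  incident : Fin n → List (Subset n)
  incident a = filter (a ∈?_) (edges C)

  c : ∀ v → Charge C A v
  c v = InSp⇒Charge C A v (spans v)

  charge-inj : Injective _≡_ _≡_ (λ v → anchor (c v) , edge (c v))
  charge-inj {v} {w} eq = Charge-injective (c v) (c w) (cong proj₁ eq) (cong proj₂ eq)

  charge∈ : ∀ v → (anchor (c v) , edge (c v)) ∈ₗ incidences A incident
  charge∈ v = ∈-incidences A incident (anchor∈A (c v))
                (∈-filter⁺ (anchor (c v) ∈?_) (edge∈C (c v)) (anchor∈edge (c v)))
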